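{- For all terms $t$, $u_1,\dots,u_m$ ($m\ge1$) and $v_1,\dots,v_n$ ($n\ge0$), and pairwise distinct variables $x_1,\dots,x_m$ such that $x_i\notin\mathrm{fv}(u_j)$ for all $i,j\in\{1,\dots,m\}$: if $u_1,\dots,u_m$ are $\lambda j$-strongly normalising and $t\{x_1/u_1\}\dots\{x_m/u_m\}\,v_1\dots v_n$ is $\lambda j$-strongly normalising, then $t[x_1/u_1]\dots[x_m/u_m]\,v_1\dots v_n$ is $\lambda j$-strongly normalising.
   Context: Terms of $\lambda j$: $t,u ::= x \mid \lambda x.t \mid t\,u \mid t[x/u]$; $[x/u]$ is a jump, $\lambda x.t$ and $t[x/u]$ bind $x$ in $t$ (not in $u$), terms modulo $\alpha$-conversion. Application associates to the left, so $s\,v_1\dots v_n=(\dots(s\,v_1)\dots)v_n$. $\mathrm{fv}(t)$ free variables, $|t|_x$ number of free occurrences of $x$ in $t$, $t\{x/u\}$ capture-avoiding meta-level substitution. When $|t|_x\ge2$, $t_{[y]_x}$ is any term obtained by renaming $i$ free occurrences of $x$ into a fresh $y$, $1\le i\le|t|_x-1$. Rules: (dB) $(\lambda x.t)L\,u\mapsto t[x/u]L$, $L=[y_1/w_1]\dots[y_k/w_k]$ a possibly empty list of jumps with $\{y_1,\dots,y_k\}\cap\mathrm{fv}(u)=\emptyset$; (w) $t[x/u]\mapsto t$ if $|t|_x=0$; (d) $t[x/u]\mapsto t\{x/u\}$ if $|t|_x=1$; (c) $t[x/u]\mapsto t_{[y]_x}[x/u][y/u]$ if $|t|_x>1$, $y$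 fresh. $\to_{\lambda j}$ is the contextual closure; strongly normalising means no infinite $\to_{\lambda j}$-sequence. -}

module Defs where

open import Data.Nat using (ℕ; zero; suc; _+_; _<_; _≤_; compare; less; equal; greater)
open import Data.Nat.Properties using (_≟_)
open import Data.List using (List; []; _∷_; length)
open import Relation.Nullary using (yes; no)
open import Relation.Binary.PropositionalEquality using (_≡_)
open import Induction.WellFounded using (Acc)

-- Terms of the λj-calculus, modulo α-conversion, in de Bruijn notation.
-- `lam t` binds index 0 in t; `es t u` is the jump t[x/u] and binds
-- index 0 in t (not in u).
data Tm : Set where
  var : ℕ → Tm
  lam : Tm → Tm
  app : Tm → Tm → Tm
  es  : Tm → Tm → Tm

sh : ℕ → Tm → Tm
sh c (var j) with compare j c
... | less _ _    = var j
... | equal _     = var (suc j)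
... | greater _ _ = var (suc j)
sh c (lam t)   = lam (sh (suc c) t)
sh c (app t u) = app (sh c t) (sh c u)
sh c (es t u)  = es (sh (suc c) t) (sh c u)

shiftBy : ℕ → Tm → Tm
shiftBy zero    u = u
shiftBy (suc k) u = sh 0 (shiftBy k u)

-- subst d u t : capture-avoiding meta-substitution t{x/u}, x = index d;
-- u lives in the context without x (it is weakened by d when inserted),
-- and free indices > d are decremented (x disappears).
subst : ℕ → Tm → Tm → Tm
subst d u (var j) with compare j d
... | less _ _    = var j
... | equal _     = shiftBy d u
... | greater _ k = var (d + k)
subst d u (lam t)   = lam (subst (suc d) u t)
subst d u (app t s) = app (subst d u t) (subst d u s)
subst d u (es t s)  = es (subst (suc d) u t) (subst d u s)

_⟨0≔_⟩ : Tm → Tm → Tm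
t ⟨0≔ u ⟩ = subst 0 u t
infixl 30 _⟨0≔_⟩
infix 4 _↦_ _⟶_

occ : ℕ → Tm → ℕ
occ d (var j) with j ≟ d
... | yes _ = 1
... | no  _ = 0
occ d (lam t)   = occ (suc d) t
occ d (app t u) = occ d t + occ d u
occ d (es t u)  = occ (suc d) t + occ d u

-- Split d t t' : t' is obtained from t by inserting a fresh variable y
-- at index d+1 (just outside x = index d) and renaming some (possibly
-- none / all) free occurrences of x into y.
data Split (d : ℕ) : Tm → Tm → Set where
  keep   : Split d (var d) (var d)
  rename : Split d (var d) (var (suc d))
  below  : ∀ {j} → j < d → Split d (var j) (var j)
  above  : ∀ {j} → d < j → Split d (var j) (var (suc j))
  lamS   : ∀ {t t'} → Split (suc d) t t' → Split d (lam t) (lam t')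
  appS   : ∀ {t t' u u'} → Split d t t' → Split d u u' → Split d (app t u) (app t' u')
  esS    : ∀ {t t' u u'} → Split (suc d) t t' → Split d u u' → Split d (es t u) (es t' u')

-- t L where L = [y1/w1]...[yk/wk] is given as the list w1 ∷ ... ∷ wk.
wrap : Tm → List Tm → Tm
wrap t []       = t
wrap t (w ∷ ws) = wrap (es t w) ws

data _↦_ : Tm → Tm → Set where
  dB : ∀ t u L → app (wrap (lam t) L) u ↦ wrap (es t (shiftBy (length L) u)) L
  w  : ∀ {t u} → occ 0 t ≡ 0 → es t u ↦ t ⟨0≔ u ⟩
  d  : ∀ {t u} → occ 0 t ≡ 1 → es t u ↦ t ⟨0≔ u ⟩
  c  : ∀ {t t' u} → 1 < occ 0 t → Split 0 t t' → 1 ≤ occ 0 t' → 1 ≤ occ 1 t'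
     → es t u ↦ es (es t' (shiftBy 1 u)) u

data _⟶_ : Tm → Tm → Set where
  root : ∀ {t t'} → t ↦ t' → t ⟶ t'
  lamC : ∀ {t t'} → t ⟶ t' → lam t ⟶ lam t'
  appL : ∀ {t t' u} → t ⟶ t' → app t u ⟶ app t' u
  appR : ∀ {t u u'} → u ⟶ u' → app t u ⟶ app t u'
  esL  : ∀ {t t' u} → t ⟶ t' → es t u ⟶ es t' u
  esR  : ∀ {t u u'} → u ⟶ u' → es t u ⟶ es t u'

SN : Tm → Set
SN = Acc (λ t' t → t ⟶ t')

apps : Tm → List Tm → Tm
apps s []       = s
apps s (v ∷ vs) = apps (app s v) vs

-- t[x1/u1]...[xm/um], with x1 = index 0, ..., xm = index m-1 in t and
-- the u_i living in the outer context (hence x_j ∉ fv(u_i)); u_i sits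
-- under the m-i binders x_{i+1},...,x_m, so it is weakened by m-i.
jumps : Tm → List Tm → Tm
jumps t []       = t
jumps t (u ∷ us) = jumps (es t (shiftBy (length us) u)) us

msubst : Tm → List Tm → Tm
msubst t []       = t
msubst t (u ∷ us) = msubst (t ⟨0≔ shiftBy (length us) u ⟩) us

-- Write σ for the simultaneous substitution of the uᵢ for the xᵢ, so that the hypothesis is
-- that (tσ) v₁…vₙ is strongly normalising.  A step of t[x₁/u₁]…[xₘ/uₘ] v₁…vₙ inside t or some
-- vₖ, or a dB step at the head (its abstraction lies in t, under some of the jumps), is mirrored
-- by a step of (tσ) v₁…vₙ, and a step inside some uᵢ by zero or more steps.  All other steps
-- (w, d or c at one of the jumps, and steps inside a uᵢ that are invisible in tσ) keep the
-- substitution image and decrease the list of pairs (uᵢ, |t|ₓᵢ) in the multiset order built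
-- from reduction of the first component (well founded since each uᵢ is SN) and the order on
-- counts: w and d delete a pair, c splits a count p + q with p, q ≥ 1 into p and q, and an
-- inner step reduces uᵢ.  A nested induction, on ⟶⁺ from (tσ) v₁…vₙ and then on this
-- order, proves the theorem.

module Submission where

open import Data.Empty using (⊥-elim)
open import Data.List using (List; []; _∷_; length; _++_; [_])
open import Data.List.Properties using (length-++; ++-assoc; ++-identityʳ)
open import Data.List.Relation.Unary.All using (All; []; _∷_)
open import Data.List.Relation.Unary.All.Properties using (++⁺; ++⁻)
open import Data.Nat using (ℕ; zero; suc; _+_; _∸_; _≤_; _<_; z≤n; s≤s; compare; less; equal; greater)
open import Data.Nat.Induction using (<-wellFounded)
open import Data.Nat.Properties
open import Data.Product using (∃; ∃₂; _×_; _,_)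
open import Data.Sum using (_⊎_; inj₁; inj₂)
open import Function using (id; _∘_; flip)
open import Induction.WellFounded using (Acc; acc)
open import Relation.Binary.Construct.Closure.ReflexiveTransitive using (Star; ε; _◅_; _◅◅_; gmap)
open import Relation.Binary.Construct.Closure.Transitive using (TransClosure; _∷ʳ_; accessible) renaming ([_] to [_]⁺)
open import Relation.Binary.Definitions using (tri<; tri≈; tri>)
open import Relation.Binary.PropositionalEquality as ≡ hiding (subst; [_])
open import Relation.Nullary using (yes; no)
open import Algebra.Properties.CommutativeSemigroup +-commutativeSemigroup using (interchange)

open import Defs

-- Renaming and simultaneous substitution

Ren : Set
Ren = ℕ → ℕ

Sub : Set
Sub = ℕ → Tm

liftRen : Ren → Ren
liftRen ρ zero    = zero
liftRen ρ (suc j) = suc (ρ j)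

ren : Ren → Tm → Tm
ren ρ (var j)   = var (ρ j)
ren ρ (lam t)   = lam (ren (liftRen ρ) t)
ren ρ (app t u) = app (ren ρ t) (ren ρ u)
ren ρ (es t u)  = es (ren (liftRen ρ) t) (ren ρ u)

lift : Sub → Sub
lift σ zero    = var zero
lift σ (suc j) = ren suc (σ j)

liftN : ℕ → Sub → Sub
liftN zero    σ = σ
liftN (suc n) σ = lift (liftN n σ)

sub : Sub → Tm → Tm
sub σ (var j)   = σ j
sub σ (lam t)   = lam (sub (lift σ) t)
sub σ (app t u) = app (sub σ t) (sub σ u)
sub σ (es t u)  = es (sub (lift σ) t) (sub σ u)

liftRen-cong : ∀ {ρ ρ'} → ρ ≗ ρ' → liftRen ρ ≗ liftRen ρ'
liftRen-cong e zero    = refl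
liftRen-cong e (suc j) = cong suc (e j)

ren-cong : ∀ {ρ ρ'} → ρ ≗ ρ' → ren ρ ≗ ren ρ'
ren-cong e (var j)   = cong var (e j)
ren-cong e (lam t)   = cong lam (ren-cong (liftRen-cong e) t)
ren-cong e (app t u) = cong₂ app (ren-cong e t) (ren-cong e u)
ren-cong e (es t u)  = cong₂ es (ren-cong (liftRen-cong e) t) (ren-cong e u)

lift-cong : ∀ {σ τ} → σ ≗ τ → lift σ ≗ lift τ
lift-cong e zero    = refl
lift-cong e (suc j) = cong (ren suc) (e j)

sub-cong : ∀ {σ τ} → σ ≗ τ → sub σ ≗ sub τ
sub-cong e (var j)   = e j
sub-cong e (lam t)   = cong lam (sub-cong (lift-cong e) t)
sub-cong e (app t u) = cong₂ app (sub-cong e t) (sub-cong e u)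
sub-cong e (es t u)  = cong₂ es (sub-cong (lift-cong e) t) (sub-cong e u)

lift-var : ∀ {σ} → σ ≗ var → lift σ ≗ var
lift-var e zero    = refl
lift-var e (suc j) = cong (ren suc) (e j)

sub-id : ∀ {σ} → σ ≗ var → sub σ ≗ id
sub-id e (var j)   = e j
sub-id e (lam t)   = cong lam (sub-id (lift-var e) t)
sub-id e (app t u) = cong₂ app (sub-id e t) (sub-id e u)
sub-id e (es t u)  = cong₂ es (sub-id (lift-var e) t) (sub-id e u)

liftRen-∘ : ∀ ρ ρ' → liftRen ρ ∘ liftRen ρ' ≗ liftRen (ρ ∘ ρ')
liftRen-∘ ρ ρ' zero    = refl
liftRen-∘ ρ ρ' (suc j) = refl

ren-∘ : ∀ ρ ρ' → ren ρ ∘ ren ρ' ≗ ren (ρ ∘ ρ')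
ren-∘ ρ ρ' (var j)   = refl
ren-∘ ρ ρ' (lam t)   = cong lam (trans (ren-∘ (liftRen ρ) (liftRen ρ') t) (ren-cong (liftRen-∘ ρ ρ') t))
ren-∘ ρ ρ' (app t u) = cong₂ app (ren-∘ ρ ρ' t) (ren-∘ ρ ρ' u)
ren-∘ ρ ρ' (es t u)  = cong₂ es (trans (ren-∘ (liftRen ρ) (liftRen ρ') t) (ren-cong (liftRen-∘ ρ ρ') t))
                                 (ren-∘ ρ ρ' u)

var-liftRen : ∀ ρ → var ∘ liftRen ρ ≗ lift (var ∘ ρ)
var-liftRen ρ zero    = refl
var-liftRen ρ (suc j) = refl

ren-as-sub : ∀ ρ → ren ρ ≗ sub (var ∘ ρ)
ren-as-sub ρ (var j)   = refl
ren-as-sub ρ (lam t)   = cong lam (trans (ren-as-sub (liftRen ρ) t) (sub-cong (var-liftRen ρ) t))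
ren-as-sub ρ (app t u) = cong₂ app (ren-as-sub ρ t) (ren-as-sub ρ u)
ren-as-sub ρ (es t u)  = cong₂ es (trans (ren-as-sub (liftRen ρ) t) (sub-cong (var-liftRen ρ) t))
                                  (ren-as-sub ρ u)

ren-id : ∀ {ρ} → ρ ≗ id → ren ρ ≗ id
ren-id {ρ} e t = trans (ren-as-sub ρ t) (sub-id (cong var ∘ e) t)

lift-liftRen : ∀ σ ρ → lift σ ∘ liftRen ρ ≗ lift (σ ∘ ρ)
lift-liftRen σ ρ zero    = refl
lift-liftRen σ ρ (suc j) = refl

sub-ren : ∀ σ ρ → sub σ ∘ ren ρ ≗ sub (σ ∘ ρ)
sub-ren σ ρ (var j)   = refl
sub-ren σ ρ (lam t)   = cong lam (trans (sub-ren (lift σ) (liftRen ρ) t) (sub-cong (lift-liftRen σ ρ) t))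
sub-ren σ ρ (app t u) = cong₂ app (sub-ren σ ρ t) (sub-ren σ ρ u)
sub-ren σ ρ (es t u)  = cong₂ es (trans (sub-ren (lift σ) (liftRen ρ) t) (sub-cong (lift-liftRen σ ρ) t))
                                 (sub-ren σ ρ u)

ren-lift : ∀ ρ σ → ren (liftRen ρ) ∘ lift σ ≗ lift (ren ρ ∘ σ)
ren-lift ρ σ zero    = refl
ren-lift ρ σ (suc j) = trans (ren-∘ (liftRen ρ) suc (σ j)) (sym (ren-∘ suc ρ (σ j)))

ren-sub : ∀ ρ σ → ren ρ ∘ sub σ ≗ sub (ren ρ ∘ σ)
ren-sub ρ σ (var j)   = refl
ren-sub ρ σ (lam t)   = cong lam (trans (ren-sub (liftRen ρ) (lift σ) t) (sub-cong (ren-lift ρ σ) t))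
ren-sub ρ σ (app t u) = cong₂ app (ren-sub ρ σ t) (ren-sub ρ σ u)
ren-sub ρ σ (es t u)  = cong₂ es (trans (ren-sub (liftRen ρ) (lift σ) t) (sub-cong (ren-lift ρ σ) t))
                                 (ren-sub ρ σ u)

sub-lift : ∀ τ σ → sub (lift τ) ∘ lift σ ≗ lift (sub τ ∘ σ)
sub-lift τ σ zero    = refl
sub-lift τ σ (suc j) = trans (sub-ren (lift τ) suc (σ j)) (sym (ren-sub suc τ (σ j)))

sub-sub : ∀ τ σ → sub τ ∘ sub σ ≗ sub (sub τ ∘ σ)
sub-sub τ σ (var j)   = refl
sub-sub τ σ (lam t)   = cong lam (trans (sub-sub (lift τ) (lift σ) t) (sub-cong (sub-lift τ σ) t))
sub-sub τ σ (app t u) = cong₂ app (sub-sub τ σ t) (sub-sub τ σ u)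
sub-sub τ σ (es t u)  = cong₂ es (trans (sub-sub (lift τ) (lift σ) t) (sub-cong (sub-lift τ σ) t))
                                 (sub-sub τ σ u)

data Offset (n : ℕ) : ℕ → Set where
  inside : ∀ {i} → i < n → Offset n i
  beyond : ∀ k → Offset n (n + k)

offset : ∀ n i → Offset n i
offset zero    i       = beyond i
offset (suc n) zero    = inside (s≤s z≤n)
offset (suc n) (suc i) with offset n i
... | inside p = inside (s≤s p)
... | beyond k = beyond k

wk : ℕ → Ren
wk zero    = suc
wk (suc m) = liftRen (wk m)

wk-< : ∀ {m j} → j < m → wk m j ≡ j
wk-< {suc m} {zero}  _       = refl
wk-< {suc m} {suc j} (s≤s p) = cong suc (wk-< p)

wk-≥ : ∀ {m j} → m ≤ j → wk m j ≡ suc j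
wk-≥ {zero}          _       = refl
wk-≥ {suc m} {suc j} (s≤s p) = cong suc (wk-≥ p)

sh-as-ren : ∀ m → sh m ≗ ren (wk m)
sh-as-ren m (var j) with compare j m
... | less .j k     = cong var (sym (wk-< (s≤s (m≤m+n j k))))
... | equal .j      = cong var (sym (wk-≥ ≤-refl))
... | greater .m k  = cong var (sym (wk-≥ (≤-trans (m≤m+n m k) (n≤1+n _))))
sh-as-ren m (lam t)   = cong lam (sh-as-ren (suc m) t)
sh-as-ren m (app t u) = cong₂ app (sh-as-ren m t) (sh-as-ren m u)
sh-as-ren m (es t u)  = cong₂ es (sh-as-ren (suc m) t) (sh-as-ren m u)

shiftBy-as-ren : ∀ n → shiftBy n ≗ ren (n +_)
shiftBy-as-ren zero    u = sym (ren-id (λ _ → refl) u)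
shiftBy-as-ren (suc n) u = begin
  sh 0 (shiftBy n u)         ≡⟨ sh-as-ren 0 (shiftBy n u) ⟩
  ren suc (shiftBy n u)      ≡⟨ cong (ren suc) (shiftBy-as-ren n u) ⟩
  ren suc (ren (n +_) u)     ≡⟨ ren-∘ suc (n +_) u ⟩
  ren (suc n +_) u           ∎
  where open ≡-Reasoning

sub₀ : Tm → Sub
sub₀ u zero    = u
sub₀ u (suc j) = var j

liftN-< : ∀ {n j} σ → j < n → liftN n σ j ≡ var j
liftN-< {suc n} {zero}  σ _       = refl
liftN-< {suc n} {suc j} σ (s≤s p) = cong (ren suc) (liftN-< σ p)

liftN-+ : ∀ n σ i → liftN n σ (n + i) ≡ ren (n +_) (σ i)
liftN-+ zero    σ i = sym (ren-id (λ _ → refl) (σ i))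
liftN-+ (suc n) σ i = trans (cong (ren suc) (liftN-+ n σ i)) (ren-∘ suc (n +_) (σ i))

subst-as-sub : ∀ n u → subst n u ≗ sub (liftN n (sub₀ u))
subst-as-sub n u (var j) with compare j n
... | less .j k    = sym (liftN-< (sub₀ u) (s≤s (m≤m+n j k)))
... | equal .j     = begin
  shiftBy j u                ≡⟨ shiftBy-as-ren j u ⟩
  ren (j +_) u               ≡⟨ liftN-+ j (sub₀ u) 0 ⟨
  liftN j (sub₀ u) (j + 0)   ≡⟨ cong (liftN j (sub₀ u)) (+-identityʳ j) ⟩
  liftN j (sub₀ u) j         ∎
  where open ≡-Reasoning
... | greater .n k = sym (trans (cong (liftN n (sub₀ u)) (sym (+-suc n k))) (liftN-+ n (sub₀ u) (suc k)))
subst-as-sub n u (lam t)   = cong lam (subst-as-sub (suc n) u t)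
subst-as-sub n u (app t s) = cong₂ app (subst-as-sub n u t) (subst-as-sub n u s)
subst-as-sub n u (es t s)  = cong₂ es (subst-as-sub (suc n) u t) (subst-as-sub n u s)

occ-var-self : ∀ j → occ j (var j) ≡ 1
occ-var-self j with j ≟ j
... | yes _ = refl
... | no ¬p = ⊥-elim (¬p refl)

occ-var-≢ : ∀ {i j} → i ≢ j → occ j (var i) ≡ 0
occ-var-≢ {i} {j} i≢j with i ≟ j
... | yes p = ⊥-elim (i≢j p)
... | no _  = refl

occ-var-suc : ∀ i j → occ (suc j) (var (suc i)) ≡ occ j (var i)
occ-var-suc i j with i ≟ j
... | yes refl = occ-var-self (suc i)
... | no i≢j   = occ-var-≢ (i≢j ∘ suc-injective)

occ-var-+ : ∀ n i j → occ (n + j) (var (n + i)) ≡ occ j (var i)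
occ-var-+ zero    i j = refl
occ-var-+ (suc n) i j = trans (occ-var-suc (n + i) (n + j)) (occ-var-+ n i j)

liftRen-occ-var : ∀ {ρ j j'} → (∀ i → occ j (var (ρ i)) ≡ occ j' (var i))
                → ∀ i → occ (suc j) (var (liftRen ρ i)) ≡ occ (suc j') (var i)
liftRen-occ-var h zero    = refl
liftRen-occ-var {ρ} {j} {j'} h (suc i) = trans (occ-var-suc (ρ i) j) (trans (h i) (sym (occ-var-suc i j')))

occ-ren-var : ∀ {ρ j j'} → (∀ i → occ j (var (ρ i)) ≡ occ j' (var i)) → ∀ x → occ j (ren ρ x) ≡ occ j' x
occ-ren-var h (var i)   = h i
occ-ren-var h (lam x)   = occ-ren-var (liftRen-occ-var h) x
occ-ren-var h (app t u) = cong₂ _+_ (occ-ren-var h t) (occ-ren-var h u)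
occ-ren-var h (es t u)  = cong₂ _+_ (occ-ren-var (liftRen-occ-var h) t) (occ-ren-var h u)

occ-suc-ren : ∀ j x → occ (suc j) (ren suc x) ≡ occ j x
occ-suc-ren j = occ-ren-var (λ i → occ-var-suc i j)

occ-shiftBy : ∀ n j u → occ (n + j) (shiftBy n u) ≡ occ j u
occ-shiftBy n j u = trans (cong (occ (n + j)) (shiftBy-as-ren n u)) (occ-ren-var (λ i → occ-var-+ n i j) u)

lift-occ-var : ∀ {σ j j'} → (∀ i → occ j (σ i) ≡ occ j' (var i))
             → ∀ i → occ (suc j) (lift σ i) ≡ occ (suc j') (var i)
lift-occ-var h zero    = refl
lift-occ-var {σ} {j} {j'} h (suc i) = trans (occ-suc-ren j (σ i)) (trans (h i) (sym (occ-var-suc i j')))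

occ-sub-var : ∀ {σ j j'} → (∀ i → occ j (σ i) ≡ occ j' (var i)) → ∀ x → occ j (sub σ x) ≡ occ j' x
occ-sub-var h (var i)   = h i
occ-sub-var h (lam x)   = occ-sub-var (lift-occ-var h) x
occ-sub-var h (app t u) = cong₂ _+_ (occ-sub-var h t) (occ-sub-var h u)
occ-sub-var h (es t u)  = cong₂ _+_ (occ-sub-var (lift-occ-var h) t) (occ-sub-var h u)

liftRen-≢ : ∀ {ρ j} → (∀ i → ρ i ≢ j) → ∀ i → liftRen ρ i ≢ suc j
liftRen-≢ h zero    ()
liftRen-≢ h (suc i) eq = h i (suc-injective eq)

occ-ren-fresh : ∀ {ρ j} → (∀ i → ρ i ≢ j) → ∀ x → occ j (ren ρ x) ≡ 0
occ-ren-fresh h (var i)   = occ-var-≢ (h i)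
occ-ren-fresh h (lam x)   = occ-ren-fresh (liftRen-≢ h) x
occ-ren-fresh h (app t u) = cong₂ _+_ (occ-ren-fresh h t) (occ-ren-fresh h u)
occ-ren-fresh h (es t u)  = cong₂ _+_ (occ-ren-fresh (liftRen-≢ h) t) (occ-ren-fresh h u)

occ-liftN-< : ∀ {n j} σ → j < n → ∀ i → occ j (liftN n σ i) ≡ occ j (var i)
occ-liftN-< {suc n}         σ _         zero    = refl
occ-liftN-< {suc n} {zero}  σ _         (suc i) = occ-ren-fresh (λ _ ()) (liftN n σ i)
occ-liftN-< {suc n} {suc j} σ (s≤s j<n) (suc i) =
  trans (occ-suc-ren j (liftN n σ i)) (trans (occ-liftN-< σ j<n i) (sym (occ-var-suc i j)))

occ-liftN-sub₀ : ∀ n {i a} → occ i a ≡ 0 → ∀ v → occ (n + i) (liftN n (sub₀ a) v) ≡ occ (suc n + i) (var v)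
occ-liftN-sub₀ zero    i∉a zero    = i∉a
occ-liftN-sub₀ zero    i∉a (suc v) = sym (occ-var-suc v _)
occ-liftN-sub₀ (suc n) i∉a zero    = refl
occ-liftN-sub₀ (suc n) {i} {a} i∉a (suc v) =
  trans (occ-suc-ren (n + i) (liftN n (sub₀ a) v)) (trans (occ-liftN-sub₀ n i∉a v) (sym (occ-var-suc v (suc n + i))))

occ-sub-liftN-< : ∀ {n j} σ → j < n → ∀ x → occ j (sub (liftN n σ) x) ≡ occ j x
occ-sub-liftN-< σ j<n = occ-sub-var (occ-liftN-< σ j<n)

occ-subst-< : ∀ {n j} a → j < n → ∀ x → occ j (subst n a x) ≡ occ j x
occ-subst-< {n} {j} a j<n x = trans (cong (occ j) (subst-as-sub n a x)) (occ-sub-liftN-< (sub₀ a) j<n x)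

occ-subst-≥ : ∀ n {i a} → occ i a ≡ 0 → ∀ x → occ (n + i) (subst n a x) ≡ occ (suc n + i) x
occ-subst-≥ n {i} {a} i∉a x = trans (cong (occ (n + i)) (subst-as-sub n a x)) (occ-sub-var (occ-liftN-sub₀ n i∉a) x)

occ-shiftBy-< : ∀ {i n} u → i < n → occ i (shiftBy n u) ≡ 0
occ-shiftBy-< {i} {n} u i<n = trans (cong (occ i) (shiftBy-as-ren n u)) (occ-ren-fresh n+m≢i u)
  where
  n+m≢i : ∀ m → n + m ≢ i
  n+m≢i m eq = <⇒≱ i<n (≤-trans (m≤m+n n m) (≤-reflexive eq))

liftRen-moves : ∀ {ρ t} → (∀ i → ρ i ≢ i → occ (suc i) t ≡ 0) → ∀ i → liftRen ρ i ≢ i → occ i t ≡ 0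
liftRen-moves h zero    moved = ⊥-elim (moved refl)
liftRen-moves h (suc i) moved = h i (moved ∘ cong suc)

ren-id-on-fv : ∀ {ρ} x → (∀ i → ρ i ≢ i → occ i x ≡ 0) → ren ρ x ≡ x
ren-id-on-fv {ρ} (var i) h with ρ i ≟ i
... | yes fixed = cong var fixed
... | no moved  = ⊥-elim (1+n≢0 (trans (sym (occ-var-self i)) (h i moved)))
ren-id-on-fv (lam x)   h = cong lam (ren-id-on-fv x (liftRen-moves {t = x} h))
ren-id-on-fv (app t u) h = cong₂ app (ren-id-on-fv t (λ i → m+n≡0⇒m≡0 _ ∘ h i))
                                     (ren-id-on-fv u (λ i → m+n≡0⇒n≡0 (occ i t) ∘ h i))
ren-id-on-fv (es t u)  h = cong₂ es (ren-id-on-fv t (liftRen-moves {t = t} (λ i → m+n≡0⇒m≡0 _ ∘ h i)))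
                                    (ren-id-on-fv u (λ i → m+n≡0⇒n≡0 (occ (suc i) t) ∘ h i))

merge : ℕ → Ren
merge zero    zero    = zero
merge zero    (suc j) = j
merge (suc n) = liftRen (merge n)

merge-< : ∀ {n j} → j < n → merge n j ≡ j
merge-< {suc n} {zero}  _       = refl
merge-< {suc n} {suc j} (s≤s p) = cong suc (merge-< p)

merge-self : ∀ n → merge n n ≡ n
merge-self zero    = refl
merge-self (suc n) = cong suc (merge-self n)

merge-suc : ∀ {n j} → n ≤ j → merge n (suc j) ≡ j
merge-suc {zero}          _       = refl
merge-suc {suc n} {suc j} (s≤s p) = cong suc (merge-suc p)

merge-+ : ∀ n k → merge n (n + suc k) ≡ n + k
merge-+ zero    k = refl
merge-+ (suc n) k = cong suc (merge-+ n k)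

merge-+0 : ∀ n → merge n (n + 0) ≡ n + 0
merge-+0 zero    = refl
merge-+0 (suc n) = cong suc (merge-+0 n)

Split-merge : ∀ {n t t'} → Split n t t' → t ≡ ren (merge n) t'
Split-merge {n} keep    = cong var (sym (merge-self n))
Split-merge rename      = cong var (sym (merge-suc ≤-refl))
Split-merge (below p)   = cong var (sym (merge-< p))
Split-merge (above p)   = cong var (sym (merge-suc (<⇒≤ p)))
Split-merge (lamS s)    = cong lam (Split-merge s)
Split-merge (appS s s') = cong₂ app (Split-merge s) (Split-merge s')
Split-merge (esS s s')  = cong₂ es (Split-merge s) (Split-merge s')

Split-wk : ∀ n x → Split n x (ren (wk (suc n)) x)
Split-wk n (var j) with <-cmp j n
... | tri< j<n _ _  rewrite wk-< {suc n} (m<n⇒m<1+n j<n) = below j<n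
... | tri≈ _ refl _ rewrite wk-< {suc n} (n<1+n j)       = keep
... | tri> _ _ n<j  rewrite wk-≥ {suc n} n<j             = above n<j
Split-wk n (lam x)   = lamS (Split-wk (suc n) x)
Split-wk n (app x y) = appS (Split-wk n x) (Split-wk n y)
Split-wk n (es x y)  = esS (Split-wk (suc n) x) (Split-wk n y)

Split-fresh : ∀ {n s a} → Split n s a → occ n s ≡ 0 → a ≡ ren (wk (suc n)) s
Split-fresh {n} keep    h = ⊥-elim (1+n≢0 (trans (sym (occ-var-self n)) h))
Split-fresh {n} rename  h = ⊥-elim (1+n≢0 (trans (sym (occ-var-self n)) h))
Split-fresh (below p)   h = cong var (sym (wk-< (m<n⇒m<1+n p)))
Split-fresh (above p)   h = cong var (sym (wk-≥ p))
Split-fresh (lamS s)    h = cong lam (Split-fresh s h)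
Split-fresh (appS s s') h = cong₂ app (Split-fresh s (m+n≡0⇒m≡0 _ h)) (Split-fresh s' (m+n≡0⇒n≡0 _ h))
Split-fresh (esS s s')  h = cong₂ es (Split-fresh s (m+n≡0⇒m≡0 _ h)) (Split-fresh s' (m+n≡0⇒n≡0 _ h))

liftN-wk : ∀ n σ j → liftN (suc n) σ (wk n j) ≡ ren (wk n) (liftN n σ j)
liftN-wk zero    σ j       = refl
liftN-wk (suc n) σ zero    = refl
liftN-wk (suc n) σ (suc j) = begin
  ren suc (liftN (suc n) σ (wk n j))           ≡⟨ cong (ren suc) (liftN-wk n σ j) ⟩
  ren suc (ren (wk n) (liftN n σ j))           ≡⟨ ren-∘ suc (wk n) (liftN n σ j) ⟩
  ren (suc ∘ wk n) (liftN n σ j)               ≡⟨ ren-∘ (wk (suc n)) suc (liftN n σ j) ⟨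
  ren (wk (suc n)) (ren suc (liftN n σ j))     ∎
  where open ≡-Reasoning

Split-sub : ∀ {n t t'} σ → Split n t t' → Split n (sub (liftN (suc n) σ) t) (sub (liftN (suc (suc n)) σ) t')
Split-sub {n} σ keep
  rewrite liftN-< σ (n<1+n n) | liftN-< σ (m<n⇒m<1+n (n<1+n n)) = keep
Split-sub {n} σ rename
  rewrite liftN-< σ (n<1+n n) = rename
Split-sub σ (below p)
  rewrite liftN-< σ (m<n⇒m<1+n p) | liftN-< σ (m<n⇒m<1+n (m<n⇒m<1+n p)) = below p
Split-sub {n} σ (above {j} p) =
  ≡.subst (Split n _) (trans (sym (liftN-wk (suc n) σ j)) (cong (liftN (suc (suc n)) σ) (wk-≥ p))) (Split-wk n _)
Split-sub σ (lamS s)    = lamS (Split-sub σ s)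
Split-sub σ (appS s s') = appS (Split-sub σ s) (Split-sub σ s')
Split-sub σ (esS s s')  = esS (Split-sub σ s) (Split-sub σ s')

occ-merge-var : ∀ n i → occ n (var (merge n i)) ≡ occ n (var i) + occ (suc n) (var i)
occ-merge-var zero    zero    = refl
occ-merge-var zero    (suc i) = sym (occ-var-suc i 0)
occ-merge-var (suc n) zero    = refl
occ-merge-var (suc n) (suc i) = begin
  occ (suc n) (var (suc (merge n i)))                          ≡⟨ occ-var-suc (merge n i) n ⟩
  occ n (var (merge n i))                                      ≡⟨ occ-merge-var n i ⟩
  occ n (var i) + occ (suc n) (var i)                          ≡⟨ cong₂ _+_ (occ-var-suc i n) (occ-var-suc i (suc n)) ⟨
  occ (suc n) (var (suc i)) + occ (suc (suc n)) (var (suc i))  ∎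
  where open ≡-Reasoning

occ-merge : ∀ n x → occ n (ren (merge n) x) ≡ occ n x + occ (suc n) x
occ-merge n (var i)   = occ-merge-var n i
occ-merge n (lam x)   = occ-merge (suc n) x
occ-merge n (app t u) = trans (cong₂ _+_ (occ-merge n t) (occ-merge n u)) (interchange (occ n t) _ _ _)
occ-merge n (es t u)  = trans (cong₂ _+_ (occ-merge (suc n) t) (occ-merge n u)) (interchange (occ (suc n) t) _ _ _)

occ-merge-var-< : ∀ {n j} → j < n → ∀ i → occ j (var (merge n i)) ≡ occ j (var i)
occ-merge-var-< {suc n}         _         zero    = refl
occ-merge-var-< {suc n} {zero}  _         (suc i) = refl
occ-merge-var-< {suc n} {suc j} (s≤s j<n) (suc i) =
  trans (occ-var-suc (merge n i) j) (trans (occ-merge-var-< j<n i) (sym (occ-var-suc i j)))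

occ-merge-var-> : ∀ n k i → occ (suc n + k) (var (merge n i)) ≡ occ (suc (suc n) + k) (var i)
occ-merge-var-> zero    k zero    = refl
occ-merge-var-> zero    k (suc i) = sym (occ-var-suc i (suc k))
occ-merge-var-> (suc n) k zero    = refl
occ-merge-var-> (suc n) k (suc i) =
  trans (occ-var-suc (merge n i) (suc n + k)) (trans (occ-merge-var-> n k i) (sym (occ-var-suc i (suc (suc n) + k))))

-- Reduction commutes with substitution

subList : Sub → List Tm → List Tm
subList σ []      = []
subList σ (l ∷ L) = sub (liftN (length L) σ) l ∷ subList σ L

length-subList : ∀ σ L → length (subList σ L) ≡ length L
length-subList σ []      = refl
length-subList σ (l ∷ L) = cong suc (length-subList σ L)

sub-wrap : ∀ σ X L → sub σ (wrap X L) ≡ wrap (sub (liftN (length L) σ) X) (subList σ L)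
sub-wrap σ X []      = refl
sub-wrap σ X (l ∷ L) = sub-wrap σ (es X l) L

sub-shiftBy : ∀ n σ u → sub (liftN n σ) (shiftBy n u) ≡ shiftBy n (sub σ u)
sub-shiftBy n σ u = begin
  sub (liftN n σ) (shiftBy n u)      ≡⟨ cong (sub (liftN n σ)) (shiftBy-as-ren n u) ⟩
  sub (liftN n σ) (ren (n +_) u)     ≡⟨ sub-ren (liftN n σ) (n +_) u ⟩
  sub (liftN n σ ∘ (n +_)) u         ≡⟨ sub-cong (liftN-+ n σ) u ⟩
  sub (ren (n +_) ∘ σ) u             ≡⟨ ren-sub (n +_) σ u ⟨
  ren (n +_) (sub σ u)               ≡⟨ shiftBy-as-ren n (sub σ u) ⟨
  shiftBy n (sub σ u)                ∎
  where open ≡-Reasoning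

sub-sub₀ : ∀ σ u → sub σ ∘ sub₀ u ≗ sub (sub₀ (sub σ u)) ∘ lift σ
sub-sub₀ σ u zero    = refl
sub-sub₀ σ u (suc j) = sym (trans (sub-ren (sub₀ (sub σ u)) suc (σ j)) (sub-id (λ _ → refl) (σ j)))

sub-⟨0≔⟩ : ∀ σ t u → sub σ (t ⟨0≔ u ⟩) ≡ sub (lift σ) t ⟨0≔ sub σ u ⟩
sub-⟨0≔⟩ σ t u = begin
  sub σ (t ⟨0≔ u ⟩)                        ≡⟨ cong (sub σ) (subst-as-sub 0 u t) ⟩
  sub σ (sub (sub₀ u) t)                   ≡⟨ sub-sub σ (sub₀ u) t ⟩
  sub (sub σ ∘ sub₀ u) t                   ≡⟨ sub-cong (sub-sub₀ σ u) t ⟩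
  sub (sub (sub₀ (sub σ u)) ∘ lift σ) t    ≡⟨ sub-sub (sub₀ (sub σ u)) (lift σ) t ⟨
  sub (sub₀ (sub σ u)) (sub (lift σ) t)    ≡⟨ subst-as-sub 0 (sub σ u) (sub (lift σ) t) ⟨
  sub (lift σ) t ⟨0≔ sub σ u ⟩             ∎
  where open ≡-Reasoning

occ-sub-lift : ∀ σ t → occ 0 (sub (lift σ) t) ≡ occ 0 t
occ-sub-lift σ = occ-sub-liftN-< {1} σ (s≤s z≤n)

↦-sub : ∀ σ {t t'} → t ↦ t' → sub σ t ↦ sub σ t'
↦-sub σ (dB t u L) =
  ≡.subst₂ _↦_ (cong (λ z → app z (sub σ u)) (sym (sub-wrap σ (lam t) L))) (sym contractum)
               (dB (sub (liftN (suc (length L)) σ) t) (sub σ u) (subList σ L))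
  where
  contractum : sub σ (wrap (es t (shiftBy (length L) u)) L)
             ≡ wrap (es (sub (liftN (suc (length L)) σ) t) (shiftBy (length (subList σ L)) (sub σ u))) (subList σ L)
  contractum = trans (sub-wrap σ _ L) (cong (λ z → wrap (es _ z) (subList σ L))
    (trans (sub-shiftBy (length L) σ u) (cong (λ n → shiftBy n (sub σ u)) (sym (length-subList σ L)))))
↦-sub σ (w {t} {u} e) = ≡.subst (sub σ (es t u) ↦_) (sym (sub-⟨0≔⟩ σ t u)) (w (trans (occ-sub-lift σ t) e))
↦-sub σ (d {t} {u} e) = ≡.subst (sub σ (es t u) ↦_) (sym (sub-⟨0≔⟩ σ t u)) (d (trans (occ-sub-lift σ t) e))
↦-sub σ (c {t} {t'} {u} h s o₁ o₂) =
  ≡.subst (sub σ (es t u) ↦_) (cong (λ z → es (es _ z) (sub σ u)) (sym (sub-shiftBy 1 σ u)))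
    (c (≡.subst (1 <_) (sym (occ-sub-lift σ t)) h) (Split-sub σ s)
       (≡.subst (1 ≤_) (sym (occ-sub-liftN-< {2} σ (s≤s z≤n) t')) o₁)
       (≡.subst (1 ≤_) (sym (occ-sub-liftN-< {2} σ (s≤s (s≤s z≤n)) t')) o₂))

⟶-sub : ∀ σ {t t'} → t ⟶ t' → sub σ t ⟶ sub σ t'
⟶-sub σ (root r) = root (↦-sub σ r)
⟶-sub σ (lamC s) = lamC (⟶-sub (lift σ) s)
⟶-sub σ (appL s) = appL (⟶-sub σ s)
⟶-sub σ (appR s) = appR (⟶-sub σ s)
⟶-sub σ (esL s)  = esL (⟶-sub (lift σ) s)
⟶-sub σ (esR s)  = esR (⟶-sub σ s)

⟶-ren : ∀ ρ {t t'} → t ⟶ t' → ren ρ t ⟶ ren ρ t'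
⟶-ren ρ {t} {t'} s = ≡.subst₂ _⟶_ (sym (ren-as-sub ρ t)) (sym (ren-as-sub ρ t')) (⟶-sub (var ∘ ρ) s)

infix 4 _⟶*_
_⟶*_ : Tm → Tm → Set
_⟶*_ = Star _⟶_

app-⟶* : ∀ {a a' b b'} → a ⟶* a' → b ⟶* b' → app a b ⟶* app a' b'
app-⟶* {b = b} p q = gmap (λ z → app z b) appL p ◅◅ gmap (app _) appR q

es-⟶* : ∀ {a a' b b'} → a ⟶* a' → b ⟶* b' → es a b ⟶* es a' b'
es-⟶* {b = b} p q = gmap (λ z → es z b) esL p ◅◅ gmap (es _) esR q

lift-⟶* : ∀ {σ τ} → (∀ j → σ j ⟶* τ j) → ∀ j → lift σ j ⟶* lift τ j
lift-⟶* h zero    = ε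
lift-⟶* h (suc j) = gmap (ren suc) (⟶-ren suc) (h j)

sub-⟶* : ∀ {σ τ} → (∀ j → σ j ⟶* τ j) → ∀ t → sub σ t ⟶* sub τ t
sub-⟶* h (var j)   = h j
sub-⟶* h (lam t)   = gmap lam lamC (sub-⟶* (lift-⟶* h) t)
sub-⟶* h (app t u) = app-⟶* (sub-⟶* h t) (sub-⟶* h u)
sub-⟶* h (es t u)  = es-⟶* (sub-⟶* (lift-⟶* h) t) (sub-⟶* h u)

-- Reduction creates no free variables

occList : ℕ → List Tm → ℕ
occList j []      = 0
occList j (l ∷ L) = occ (length L + j) l + occList j L

occ-wrap : ∀ j X L → occ j (wrap X L) ≡ occ (length L + j) X + occList j L
occ-wrap j X []      = sym (+-identityʳ (occ j X))
occ-wrap j X (l ∷ L) = trans (occ-wrap j (es X l) L) (+-assoc (occ (suc (length L + j)) X) _ _)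

⟨0≔⟩-fresh : ∀ j t u → occ j (es t u) ≡ 0 → occ j (t ⟨0≔ u ⟩) ≡ 0
⟨0≔⟩-fresh j t u h = trans (occ-subst-≥ 0 (m+n≡0⇒n≡0 (occ (suc j) t) h) t) (m+n≡0⇒m≡0 _ h)

↦-fresh : ∀ j {r r'} → r ↦ r' → occ j r ≡ 0 → occ j r' ≡ 0
↦-fresh j (dB t u L) h = begin
  occ j (wrap (es t (shiftBy (length L) u)) L)                   ≡⟨ occ-wrap j _ L ⟩
  (A + occ (length L + j) (shiftBy (length L) u)) + occList j L  ≡⟨ cong (λ z → A + z + occList j L) u-fresh ⟩
  (A + 0) + occList j L                                          ≡⟨ cong (_+ occList j L) (+-identityʳ A) ⟩
  A + occList j L                                                ≡⟨ occ-wrap j (lam t) L ⟨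
  occ j (wrap (lam t) L)                                         ≡⟨ m+n≡0⇒m≡0 _ h ⟩
  0                                                              ∎
  where
  open ≡-Reasoning
  A = occ (suc (length L + j)) t
  u-fresh = trans (occ-shiftBy (length L) j u) (m+n≡0⇒n≡0 (occ j (wrap (lam t) L)) h)
↦-fresh j (w {t} {u} _) = ⟨0≔⟩-fresh j t u
↦-fresh j (d {t} {u} _) = ⟨0≔⟩-fresh j t u
↦-fresh j (c {t} {t'} {u} _ s _ _) h = cong₂ _+_ (cong₂ _+_ t'∉ (trans (occ-shiftBy 1 j u) u∉)) u∉
  where
  u∉ = m+n≡0⇒n≡0 (occ (suc j) t) h
  t'∉ : occ (suc (suc j)) t' ≡ 0
  t'∉ = trans (sym (occ-ren-var (occ-merge-var-> 0 j) t'))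
              (trans (cong (occ (suc j)) (sym (Split-merge s))) (m+n≡0⇒m≡0 _ h))

⟶-fresh : ∀ j {r r'} → r ⟶ r' → occ j r ≡ 0 → occ j r' ≡ 0
⟶-fresh j (root ρ) h = ↦-fresh j ρ h
⟶-fresh j (lamC s) h = ⟶-fresh (suc j) s h
⟶-fresh j (appL {t} s) h = cong₂ _+_ (⟶-fresh j s (m+n≡0⇒m≡0 _ h)) (m+n≡0⇒n≡0 (occ j t) h)
⟶-fresh j (appR {t} s) h = cong₂ _+_ (m+n≡0⇒m≡0 _ h) (⟶-fresh j s (m+n≡0⇒n≡0 (occ j t) h))
⟶-fresh j (esL {t} s)  h = cong₂ _+_ (⟶-fresh (suc j) s (m+n≡0⇒m≡0 _ h)) (m+n≡0⇒n≡0 (occ (suc j) t) h)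
⟶-fresh j (esR {t} s)  h = cong₂ _+_ (m+n≡0⇒m≡0 _ h) (⟶-fresh j s (m+n≡0⇒n≡0 (occ (suc j) t) h))

-- The renaming (_∸ n) undoes the shift on every variable free in the reduct, since reduction
-- creates no free variables.
shiftBy-⟶-inv : ∀ n u {w'} → shiftBy n u ⟶ w' → ∃ λ u' → u ⟶ u' × w' ≡ shiftBy n u'
shiftBy-⟶-inv n u {w'} s = ren (_∸ n) w' , ≡.subst (_⟶ _) unshift-shift (⟶-ren (_∸ n) s) , sym shift-unshift
  where
  unshift-shift : ren (_∸ n) (shiftBy n u) ≡ u
  unshift-shift = trans (cong (ren (_∸ n)) (shiftBy-as-ren n u))
                        (trans (ren-∘ (_∸ n) (n +_) u) (ren-id (m+n∸m≡n n) u))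
  below-n-fresh : ∀ i → n + (i ∸ n) ≢ i → occ i w' ≡ 0
  below-n-fresh i moved with offset n i
  ... | inside i<n = ⟶-fresh i s (occ-shiftBy-< u i<n)
  ... | beyond k   = ⊥-elim (moved (cong (n +_) (m+n∸m≡n n k)))
  shift-unshift : shiftBy n (ren (_∸ n) w') ≡ w'
  shift-unshift = trans (shiftBy-as-ren n _)
                        (trans (ren-∘ (n +_) (_∸ n) w') (ren-id-on-fv w' below-n-fresh))

shiftBy-+ : ∀ m n u → shiftBy (m + n) u ≡ shiftBy m (shiftBy n u)
shiftBy-+ zero    n u = refl
shiftBy-+ (suc m) n u = cong (sh 0) (shiftBy-+ m n u)

wrap-++ : ∀ X L₁ L₂ → wrap X (L₁ ++ L₂) ≡ wrap (wrap X L₁) L₂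
wrap-++ X []       L₂ = refl
wrap-++ X (l ∷ L₁) L₂ = wrap-++ (es X l) L₁ L₂

wrap-app : ∀ X L {h v} → wrap X L ≡ app h v → L ≡ []
wrap-app X []      e = refl
wrap-app X (l ∷ L) e with wrap-app (es X l) L e
... | refl with e
... | ()

wrap-es : ∀ X L {t u} → wrap X L ≡ es t u → (L ≡ [] × X ≡ es t u) ⊎ ∃ λ L₁ → L ≡ L₁ ++ [ u ] × t ≡ wrap X L₁
wrap-es X []      e = inj₁ (refl , e)
wrap-es X (l ∷ L) e with wrap-es (es X l) L e
... | inj₁ (refl , refl)    = inj₂ ([] , refl , refl)
... | inj₂ (L₁ , refl , e') = inj₂ (l ∷ L₁ , refl , e')

wrap-lam-suffix : ∀ A {t a L} → wrap (lam a) L ≡ wrap t A → ∃ λ L₀ → t ≡ wrap (lam a) L₀ × L ≡ L₀ ++ A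
wrap-lam-suffix []          {L = L} e = L , sym e , sym (++-identityʳ L)
wrap-lam-suffix (x ∷ A) e with wrap-lam-suffix A e
... | L₀ , e₀ , L≡L₀++A with wrap-es (lam _) L₀ (sym e₀)
...   | inj₁ (_ , ())
...   | inj₂ (L₁ , refl , e₁) = L₁ , e₁ , trans L≡L₀++A (++-assoc L₁ [ x ] A)

dB-inv : ∀ {H v r} → app H v ↦ r → ∃₂ λ a L → H ≡ wrap (lam a) L × r ≡ wrap (es a (shiftBy (length L) v)) L
dB-inv (dB a v L) = a , L , refl , refl

jumpsAt : ℕ → Tm → List Tm → Tm
jumpsAt k t []       = t
jumpsAt k t (u ∷ us) = jumpsAt k (es t (shiftBy (k + length us) u)) us

jumps-++ : ∀ t xs ys → jumps t (xs ++ ys) ≡ jumps (jumpsAt (length ys) t xs) ys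
jumps-++ t []       ys = refl
jumps-++ t (x ∷ xs) ys = trans (jumps-++ (es t (shiftBy (length (xs ++ ys)) x)) xs ys)
  (cong (λ m → jumps (jumpsAt (length ys) (es t (shiftBy m x)) xs) ys)
    (trans (length-++ xs) (+-comm (length xs) (length ys))))

subst-shiftBy : ∀ e p s x → subst e s (shiftBy (suc p + e) x) ≡ shiftBy (p + e) x
subst-shiftBy e p s x = begin
  subst e s (shiftBy (suc p + e) x)     ≡⟨ subst-as-sub e s (shiftBy (suc p + e) x) ⟩
  sub σ (shiftBy (suc p + e) x)         ≡⟨ cong (sub σ) (shiftBy-as-ren (suc p + e) x) ⟩
  sub σ (ren (suc p + e +_) x)          ≡⟨ sub-ren σ _ x ⟩
  sub (σ ∘ (suc p + e +_)) x            ≡⟨ sub-cong pointwise x ⟩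
  sub (var ∘ (p + e +_)) x              ≡⟨ ren-as-sub (p + e +_) x ⟨
  ren (p + e +_) x                      ≡⟨ shiftBy-as-ren (p + e) x ⟨
  shiftBy (p + e) x                     ∎
  where
  open ≡-Reasoning
  σ = liftN e (sub₀ s)
  reassoc : ∀ j → p + e + j ≡ e + (p + j)
  reassoc j = trans (cong (_+ j) (+-comm p e)) (+-assoc e p j)
  pointwise : σ ∘ (suc p + e +_) ≗ var ∘ (p + e +_)
  pointwise j = trans (cong σ (trans (cong suc (reassoc j)) (sym (+-suc e (p + j)))))
                      (trans (liftN-+ e (sub₀ s) (suc (p + j))) (cong var (sym (reassoc j))))

subst-jumpsAt : ∀ n s T xs → subst 0 s (jumpsAt (suc n) T xs) ≡ jumpsAt n (subst (length xs) s T) xs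
subst-jumpsAt n s T []       = refl
subst-jumpsAt n s T (x ∷ xs) = trans (subst-jumpsAt n s (es T (shiftBy (suc n + length xs) x)) xs)
  (cong (λ z → jumpsAt n (es (subst (suc (length xs)) s T) z) xs) (subst-shiftBy (length xs) n s x))

wk-shiftBy : ∀ {m k} x → m ≤ k → ren (wk m) (shiftBy k x) ≡ shiftBy (suc k) x
wk-shiftBy {m} {k} x m≤k = begin
  ren (wk m) (shiftBy k x)        ≡⟨ cong (ren (wk m)) (shiftBy-as-ren k x) ⟩
  ren (wk m) (ren (k +_) x)       ≡⟨ ren-∘ (wk m) (k +_) x ⟩
  ren (wk m ∘ (k +_)) x           ≡⟨ ren-cong (λ j → wk-≥ (≤-trans m≤k (m≤m+n k j))) x ⟩
  ren (suc k +_) x                ≡⟨ shiftBy-as-ren (suc k) x ⟨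
  shiftBy (suc k) x               ∎
  where open ≡-Reasoning

Split-jumpsAt : ∀ n T xs {B'} → Split 0 (jumpsAt (suc n) T xs) B'
              → ∃ λ T' → Split (length xs) T T' × B' ≡ jumpsAt (suc (suc n)) T' xs
Split-jumpsAt n T []       s = _ , s , refl
Split-jumpsAt n T (x ∷ xs) s with Split-jumpsAt n (es T (shiftBy (suc n + length xs) x)) xs s
... | _ , esS {t' = T'} sT sx , B'≡ = T' , sT , trans B'≡ (cong (λ z → jumpsAt (suc (suc n)) (es T' z) xs) x-untouched)
  where
  xs<shift : length xs < suc n + length xs
  xs<shift = s≤s (m≤n+m (length xs) n)
  x-untouched = trans (Split-fresh sx (occ-shiftBy-< x xs<shift)) (wk-shiftBy x xs<shift)

occ-jumpsAt : ∀ {j n} T xs → j < n → occ j (jumpsAt n T xs) ≡ occ (j + length xs) T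
occ-jumpsAt {j} T []       j<n = cong (λ m → occ m T) (sym (+-identityʳ j))
occ-jumpsAt {j} {n} T (x ∷ xs) j<n = begin
  occ j (jumpsAt n (es T (shiftBy (n + length xs) x)) xs)       ≡⟨ occ-jumpsAt (es T _) xs j<n ⟩
  occ (suc m) T + occ m (shiftBy (n + length xs) x)              ≡⟨ cong (occ (suc m) T +_) x-fresh ⟩
  occ (suc m) T + 0                                              ≡⟨ +-identityʳ _ ⟩
  occ (suc m) T                                                  ≡⟨ cong (λ k → occ k T) (+-suc j (length xs)) ⟨
  occ (j + suc (length xs)) T                                    ∎
  where
  open ≡-Reasoning
  m = j + length xs
  x-fresh = occ-shiftBy-< x (+-monoˡ-< (length xs) j<n)

jumpArgs : List Tm → List Tm
jumpArgs []       = []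
jumpArgs (x ∷ xs) = shiftBy (length xs) x ∷ jumpArgs xs

length-jumpArgs : ∀ xs → length (jumpArgs xs) ≡ length xs
length-jumpArgs []       = refl
length-jumpArgs (x ∷ xs) = cong suc (length-jumpArgs xs)

jumps-as-wrap : ∀ t xs → jumps t xs ≡ wrap t (jumpArgs xs)
jumps-as-wrap t []       = refl
jumps-as-wrap t (x ∷ xs) = jumps-as-wrap (es t (shiftBy (length xs) x)) xs

dB-under-jumps : ∀ t us v {r} → app (jumps t us) v ↦ r
               → ∃ λ t⁺ → app t (shiftBy (length us) v) ↦ t⁺ × r ≡ jumps t⁺ us
dB-under-jumps t us v ρ with dB-inv ρ
... | a , L , eH , refl with wrap-lam-suffix (jumpArgs us) {t} {a} {L} (trans (sym eH) (jumps-as-wrap t us))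
...   | L₀ , t≡ , refl = t⁺ , ≡.subst (λ z → app z v' ↦ t⁺) (sym t≡) (dB a v' L₀) , reduct
  where
  open ≡-Reasoning
  v' = shiftBy (length us) v
  t⁺ = wrap (es a (shiftBy (length L₀) v')) L₀
  args = jumpArgs us
  shift-v : shiftBy (length (L₀ ++ args)) v ≡ shiftBy (length L₀) v'
  shift-v = begin
    shiftBy (length (L₀ ++ args)) v        ≡⟨ cong (λ m → shiftBy m v) (length-++ L₀) ⟩
    shiftBy (length L₀ + length args) v    ≡⟨ cong (λ m → shiftBy (length L₀ + m) v) (length-jumpArgs us) ⟩
    shiftBy (length L₀ + length us) v      ≡⟨ shiftBy-+ (length L₀) (length us) v ⟩
    shiftBy (length L₀) v'                 ∎
  reduct : wrap (es a (shiftBy (length (L₀ ++ args)) v)) (L₀ ++ args) ≡ jumps t⁺ us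
  reduct = begin
    wrap (es a (shiftBy (length (L₀ ++ args)) v)) (L₀ ++ args)   ≡⟨ cong (λ z → wrap (es a z) (L₀ ++ args)) shift-v ⟩
    wrap (es a (shiftBy (length L₀) v')) (L₀ ++ args)            ≡⟨ wrap-++ _ L₀ args ⟩
    wrap (wrap (es a (shiftBy (length L₀) v')) L₀) args          ≡⟨ jumps-as-wrap _ us ⟨
    jumps t⁺ us                                                  ∎

infix 4 _⟶ₗ_
data _⟶ₗ_ : List Tm → List Tm → Set where
  here  : ∀ {u u' us} → u ⟶ u' → u ∷ us ⟶ₗ u' ∷ us
  there : ∀ {u us us'} → us ⟶ₗ us' → u ∷ us ⟶ₗ u ∷ us'

length-⟶ₗ : ∀ {us us'} → us ⟶ₗ us' → length us' ≡ length us
length-⟶ₗ (here _)  = refl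
length-⟶ₗ (there p) = cong suc (length-⟶ₗ p)

apps-⟶ˡ : ∀ {h h'} vs → h ⟶ h' → apps h vs ⟶ apps h' vs
apps-⟶ˡ []       s = s
apps-⟶ˡ (v ∷ vs) s = apps-⟶ˡ vs (appL s)

apps-⟶ʳ : ∀ h {vs vs'} → vs ⟶ₗ vs' → apps h vs ⟶ apps h vs'
apps-⟶ʳ h {v ∷ vs} (here s)  = apps-⟶ˡ vs (appR s)
apps-⟶ʳ h {v ∷ vs} (there p) = apps-⟶ʳ (app h v) p

data AppsStep (h : Tm) : List Tm → Tm → Set where
  head      : ∀ {vs h'} → h ⟶ h' → AppsStep h vs (apps h' vs)
  args      : ∀ {vs vs'} → vs ⟶ₗ vs' → AppsStep h vs (apps h vs')
  headRedex : ∀ {v vs r} → app h v ↦ r → AppsStep h (v ∷ vs) (apps r vs)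

apps-⟶-inv : ∀ h vs {r} → apps h vs ⟶ r → AppsStep h vs r
apps-⟶-inv h []       s = head s
apps-⟶-inv h (v ∷ vs) s with apps-⟶-inv (app h v) vs s
... | head (appL s')  = head s'
... | head (appR s')  = args (here s')
... | head (root ρ)   = headRedex ρ
... | args p          = args (there p)
... | headRedex ρ with dB-inv ρ
...   | a , L , e , _ with wrap-app (lam a) L (sym e)
...     | refl with e
...       | ()

data JumpsStep (t : Tm) : List Tm → Tm → Set where
  body      : ∀ {us t'} → t ⟶ t' → JumpsStep t us (jumps t' us)
  jumpArg   : ∀ {us us'} → us ⟶ₗ us' → JumpsStep t us (jumps t us')
  jumpRedex : ∀ xs u ys {r} → es (jumpsAt (suc (length ys)) t xs) (shiftBy (length ys) u) ↦ r
            → JumpsStep t (xs ++ u ∷ ys) (jumps r ys)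

jumps-⟶-inv : ∀ t us {r} → jumps t us ⟶ r → JumpsStep t us r
jumps-⟶-inv t []       s = body s
jumps-⟶-inv t (u ∷ us) s with jumps-⟶-inv (es t (shiftBy (length us) u)) us s
... | body (esL s') = body s'
... | body (esR s') with shiftBy-⟶-inv (length us) u s'
...   | u' , s'' , refl = jumpArg (here s'')
jumps-⟶-inv t (u ∷ us) s | body (root ρ) = jumpRedex [] u us ρ
jumps-⟶-inv t (u ∷ us) s | jumpArg {us' = us'} p =
  ≡.subst (JumpsStep t (u ∷ us)) (cong (λ m → jumps (es t (shiftBy m u)) us') (length-⟶ₗ p)) (jumpArg (there p))
jumps-⟶-inv t (u ∷ .(xs ++ u' ∷ ys)) s | jumpRedex xs u' ys {r} ρ =
  jumpRedex (u ∷ xs) u' ys (≡.subst (λ m → es (jumpsAt (suc (length ys)) (es t (shiftBy m u)) xs) _ ↦ r) length-split ρ)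
  where
  length-split : length (xs ++ u' ∷ ys) ≡ suc (length ys) + length xs
  length-split = trans (length-++ xs) (+-comm (length xs) _)

listSub : List Tm → Sub
listSub []       j       = var j
listSub (u ∷ us) zero    = u
listSub (u ∷ us) (suc j) = listSub us j

listSub-++-+ : ∀ xs ys j → listSub (xs ++ ys) (length xs + j) ≡ listSub ys j
listSub-++-+ []       ys j = refl
listSub-++-+ (x ∷ xs) ys j = listSub-++-+ xs ys j

listSub-++-< : ∀ xs ys zs {j} → j < length xs → listSub (xs ++ ys) j ≡ listSub (xs ++ zs) j
listSub-++-< (x ∷ xs) ys zs {zero}  _       = refl
listSub-++-< (x ∷ xs) ys zs {suc j} (s≤s p) = listSub-++-< xs ys zs p

listSub-beyond : ∀ us j → listSub us (length us + j) ≡ var j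
listSub-beyond []       j = refl
listSub-beyond (u ∷ us) j = listSub-beyond us j

listSub-shiftBy : ∀ us u → sub (listSub us) (shiftBy (length us) u) ≡ u
listSub-shiftBy us u = begin
  sub (listSub us) (shiftBy (length us) u)        ≡⟨ cong (sub (listSub us)) (shiftBy-as-ren (length us) u) ⟩
  sub (listSub us) (ren (length us +_) u)         ≡⟨ sub-ren (listSub us) (length us +_) u ⟩
  sub (listSub us ∘ (length us +_)) u             ≡⟨ sub-id (listSub-beyond us) u ⟩
  u                                               ∎
  where open ≡-Reasoning

msubst-as-sub : ∀ t us → msubst t us ≡ sub (listSub us) t
msubst-as-sub t []       = sym (sub-id (λ _ → refl) t)
msubst-as-sub t (u ∷ us) = begin
  msubst (t ⟨0≔ a ⟩) us                      ≡⟨ msubst-as-sub (t ⟨0≔ a ⟩) us ⟩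
  sub (listSub us) (t ⟨0≔ a ⟩)               ≡⟨ cong (sub (listSub us)) (subst-as-sub 0 a t) ⟩
  sub (listSub us) (sub (sub₀ a) t)          ≡⟨ sub-sub (listSub us) (sub₀ a) t ⟩
  sub (sub (listSub us) ∘ sub₀ a) t          ≡⟨ sub-cong head-first t ⟩
  sub (listSub (u ∷ us)) t                   ∎
  where
  open ≡-Reasoning
  a = shiftBy (length us) u
  head-first : sub (listSub us) ∘ sub₀ a ≗ listSub (u ∷ us)
  head-first zero    = listSub-shiftBy us u
  head-first (suc j) = refl

listSub-erase : ∀ xs u ys t → sub (listSub (xs ++ ys)) (subst (length xs) (shiftBy (length ys) u) t)
                            ≡ sub (listSub (xs ++ u ∷ ys)) t
listSub-erase xs u ys t = begin
  sub σ (subst n a t)                 ≡⟨ cong (sub σ) (subst-as-sub n a t) ⟩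
  sub σ (sub (liftN n (sub₀ a)) t)    ≡⟨ sub-sub σ (liftN n (sub₀ a)) t ⟩
  sub (sub σ ∘ liftN n (sub₀ a)) t    ≡⟨ sub-cong pointwise t ⟩
  sub (listSub (xs ++ u ∷ ys)) t      ∎
  where
  n = length xs
  a = shiftBy (length ys) u
  σ = listSub (xs ++ ys)
  open ≡-Reasoning
  pointwise : sub σ ∘ liftN n (sub₀ a) ≗ listSub (xs ++ u ∷ ys)
  pointwise i with offset n i
  ... | inside i<n  = trans (cong (sub σ) (liftN-< (sub₀ a) i<n)) (listSub-++-< xs ys (u ∷ ys) i<n)
  ... | beyond zero = begin
    sub σ (liftN n (sub₀ a) (n + 0))     ≡⟨ cong (sub σ) (liftN-+ n (sub₀ a) 0) ⟩
    sub σ (ren (n +_) a)                 ≡⟨ sub-ren σ (n +_) a ⟩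
    sub (σ ∘ (n +_)) a                   ≡⟨ sub-cong (listSub-++-+ xs ys) a ⟩
    sub (listSub ys) a                   ≡⟨ listSub-shiftBy ys u ⟩
    u                                    ≡⟨ listSub-++-+ xs (u ∷ ys) 0 ⟨
    listSub (xs ++ u ∷ ys) (n + 0)       ∎
  ... | beyond (suc k) = trans (cong (sub σ) (liftN-+ n (sub₀ a) (suc k)))
                               (trans (listSub-++-+ xs ys k) (sym (listSub-++-+ xs (u ∷ ys) (suc k))))

listSub-duplicate : ∀ xs u ys t' → sub (listSub (xs ++ u ∷ ys)) (ren (merge (length xs)) t')
                                ≡ sub (listSub (xs ++ u ∷ u ∷ ys)) t'
listSub-duplicate xs u ys t' = trans (sub-ren σ (merge n) t') (sub-cong pointwise t')
  where
  n = length xs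
  σ = listSub (xs ++ u ∷ ys)
  pointwise : σ ∘ merge n ≗ listSub (xs ++ u ∷ u ∷ ys)
  pointwise i with offset n i
  ... | inside i<n     = trans (cong σ (merge-< i<n)) (listSub-++-< xs (u ∷ ys) (u ∷ u ∷ ys) i<n)
  ... | beyond zero    = trans (cong σ (merge-+0 n))
                               (trans (listSub-++-+ xs (u ∷ ys) 0) (sym (listSub-++-+ xs (u ∷ u ∷ ys) 0)))
  ... | beyond (suc k) = trans (cong σ (merge-+ n k))
                               (trans (listSub-++-+ xs (u ∷ ys) k) (sym (listSub-++-+ xs (u ∷ u ∷ ys) (suc k))))

head-dB-simulation : ∀ t us v {r} → app (jumps t us) v ↦ r
                   → ∃ λ t⁺ → r ≡ jumps t⁺ us × app (sub (listSub us) t) v ⟶ sub (listSub us) t⁺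
head-dB-simulation t us v ρ with dB-under-jumps t us v ρ
... | t⁺ , ρ' , r≡ = t⁺ , r≡ , root (≡.subst (λ z → app (sub σ t) z ↦ sub σ t⁺) (listSub-shiftBy us v) (↦-sub σ ρ'))
  where
  σ = listSub us

-- The termination order

Entry : Set
Entry = Tm × ℕ

infix 4 _≺_ _≺ₘ_
data _≺_ : Entry → Entry → Set where
  reduce : ∀ {u u' k k'} → u ⟶ u' → (u' , k') ≺ (u , k)
  fewer  : ∀ {u k k'} → k' < k → (u , k') ≺ (u , k)

≺-acc : ∀ {u k} → SN u → Acc _<_ k → Acc _≺_ (u , k)
≺-acc sn-u acc-k = acc (smaller sn-u acc-k)
  where
  smaller : ∀ {u k} → SN u → Acc _<_ k → ∀ {e} → e ≺ (u , k) → Acc _≺_ e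
  smaller (acc sn-u) _           (reduce s) = acc (smaller (sn-u s) (<-wellFounded _))
  smaller sn-u       (acc acc-k) (fewer p)  = acc (smaller sn-u (acc-k p))

-- The multiset extension of ≺, restricted to replacing one entry in place: jumps are erased,
-- duplicated or reduced where they stand.
data _≺ₘ_ : List Entry → List Entry → Set where
  replace : ∀ {a bs ys} → All (_≺ a) bs → bs ++ ys ≺ₘ a ∷ ys
  skip    : ∀ {a ys ys'} → ys' ≺ₘ ys → a ∷ ys' ≺ₘ a ∷ ys

≺ₘ-++ˡ : ∀ xs {ys ys'} → ys' ≺ₘ ys → xs ++ ys' ≺ₘ xs ++ ys
≺ₘ-++ˡ []       q = q
≺ₘ-++ˡ (x ∷ xs) q = skip (≺ₘ-++ˡ xs q)

∷-acc : ∀ {a ys} → Acc _≺_ a → Acc _≺ₘ_ ys → Acc _≺ₘ_ (a ∷ ys)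
∷-acc acc-a acc-ys = acc (under acc-a acc-ys)
  where
  under : ∀ {a ys} → Acc _≺_ a → Acc _≺ₘ_ ys → ∀ {zs} → zs ≺ₘ a ∷ ys → Acc _≺ₘ_ zs
  prefix-acc : ∀ {a ys bs} → (∀ {b} → b ≺ a → Acc _≺_ b) → Acc _≺ₘ_ ys → All (_≺ a) bs → Acc _≺ₘ_ (bs ++ ys)
  under (acc acc-a) acc-ys (replace bs≺a) = prefix-acc acc-a acc-ys bs≺a
  under acc-a (acc acc-ys) (skip q)       = acc (under acc-a (acc-ys q))
  prefix-acc acc-a acc-ys []         = acc-ys
  prefix-acc acc-a acc-ys (b≺a ∷ ps) = acc (under (acc-a b≺a) (prefix-acc acc-a acc-ys ps))

weights : ℕ → Tm → List Tm → List Entry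
weights n t []       = []
weights n t (u ∷ us) = (u , occ n t) ∷ weights (suc n) t us

weights-++ : ∀ n t xs ys → weights n t (xs ++ ys) ≡ weights n t xs ++ weights (n + length xs) t ys
weights-++ n t []       ys = cong (λ m → weights m t ys) (sym (+-identityʳ n))
weights-++ n t (x ∷ xs) ys = cong ((x , occ n t) ∷_) (trans (weights-++ (suc n) t xs ys)
  (cong (λ m → weights (suc n) t xs ++ weights m t ys) (sym (+-suc n (length xs)))))

weights-cong : ∀ n m t₁ t₂ us → (∀ i → i < length us → occ (n + i) t₁ ≡ occ (m + i) t₂)
             → weights n t₁ us ≡ weights m t₂ us
weights-cong n m t₁ t₂ []       h = refl
weights-cong n m t₁ t₂ (u ∷ us) h = cong₂ _∷_ (cong (u ,_) first) (weights-cong (suc n) (suc m) t₁ t₂ us rest)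
  where
  first : occ n t₁ ≡ occ m t₂
  first = ≡.subst₂ (λ a b → occ a t₁ ≡ occ b t₂) (+-identityʳ n) (+-identityʳ m) (h 0 (s≤s z≤n))
  rest : ∀ i → i < length us → occ (suc n + i) t₁ ≡ occ (suc m + i) t₂
  rest i i<us = ≡.subst₂ (λ a b → occ a t₁ ≡ occ b t₂) (+-suc n i) (+-suc m i) (h (suc i) (s≤s i<us))

weights-acc : ∀ {us} → All SN us → ∀ n t → Acc _≺ₘ_ (weights n t us)
weights-acc []           n t = acc λ ()
weights-acc (sn ∷ sn-us) n t = ∷-acc (≺-acc sn (<-wellFounded _)) (weights-acc sn-us (suc n) t)

weights-⟶ₗ : ∀ {us us'} n t → us ⟶ₗ us' → weights n t us' ≺ₘ weights n t us
weights-⟶ₗ n t (here s)  = replace (reduce s ∷ [])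
weights-⟶ₗ n t (there p) = skip (weights-⟶ₗ (suc n) t p)

listSub-⟶ₗ : ∀ {us us'} → us ⟶ₗ us' → ∀ j → listSub us j ⟶* listSub us' j
listSub-⟶ₗ (here s)  zero    = s ◅ ε
listSub-⟶ₗ (here s)  (suc j) = ε
listSub-⟶ₗ (there p) zero    = ε
listSub-⟶ₗ (there p) (suc j) = listSub-⟶ₗ p j

All-⟶ₗ : ∀ {us us'} → All SN us → us ⟶ₗ us' → All SN us'
All-⟶ₗ (acc sn ∷ sn-us) (here s) = sn s ∷ sn-us
All-⟶ₗ (sn ∷ sn-us)     (there p) = sn ∷ All-⟶ₗ sn-us p

record JumpContraction (t : Tm) (us : List Tm) (r : Tm) : Set where
  field
    t'         : Tm
    us'        : List Tm
    reduct     : r ≡ jumps t' us'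
    same-image : sub (listSub us') t' ≡ sub (listSub us) t
    smaller    : weights 0 t' us' ≺ₘ weights 0 t us
    sn-args    : All SN us → All SN us'

erase-jump : ∀ t xs u ys
           → JumpContraction t (xs ++ u ∷ ys) (jumps (jumpsAt (suc (length ys)) t xs ⟨0≔ shiftBy (length ys) u ⟩) ys)
erase-jump t xs u ys = record
  { t'         = t''
  ; us'        = xs ++ ys
  ; reduct     = trans (cong (λ z → jumps z ys) (subst-jumpsAt (length ys) a t xs)) (sym (jumps-++ t'' xs ys))
  ; same-image = listSub-erase xs u ys t
  ; smaller    = ≡.subst₂ _≺ₘ_ (sym (trans (weights-++ 0 t'' xs ys) (cong₂ _++_ prefix suffix)))
                               (sym (weights-++ 0 t xs (u ∷ ys))) (≺ₘ-++ˡ (weights 0 t xs) (replace []))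
  ; sn-args    = erase
  }
  where
  a = shiftBy (length ys) u
  e = length xs
  t'' = subst e a t
  prefix : weights 0 t'' xs ≡ weights 0 t xs
  prefix = weights-cong 0 0 t'' t xs (λ i i<e → occ-subst-< a i<e t)
  suffix : weights e t'' ys ≡ weights (suc e) t ys
  suffix = weights-cong e (suc e) t'' t ys (λ i i<ys → occ-subst-≥ e (occ-shiftBy-< u i<ys) t)
  erase : All SN (xs ++ u ∷ ys) → All SN (xs ++ ys)
  erase sn with ++⁻ xs sn
  ... | sn-xs , _ ∷ sn-ys = ++⁺ sn-xs sn-ys

duplicate-jump : ∀ t xs u ys {B'} → Split 0 (jumpsAt (suc (length ys)) t xs) B' → 1 ≤ occ 0 B' → 1 ≤ occ 1 B'
               → let a = shiftBy (length ys) u in JumpContraction t (xs ++ u ∷ ys) (jumps (es (es B' (shiftBy 1 a)) a) ys)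
duplicate-jump t xs u ys split o₀ o₁ with Split-jumpsAt (length ys) t xs split
... | t' , s , B'≡ = record
  { t'         = t'
  ; us'        = xs ++ u ∷ u ∷ ys
  ; reduct     = trans (cong (λ z → jumps (es (es z _) _) ys) B'≡) (sym (jumps-++ t' xs (u ∷ u ∷ ys)))
  ; same-image = trans (sym (listSub-duplicate xs u ys t')) (cong (sub (listSub (xs ++ u ∷ ys))) (sym t≡))
  ; smaller    = ≡.subst₂ _≺ₘ_ (sym (trans (weights-++ 0 t' xs (u ∷ u ∷ ys))
                                           (cong₂ _++_ prefix (cong (λ z → _ ∷ _ ∷ z) suffix))))
                               (sym (weights-++ 0 t xs (u ∷ ys)))
                               (≺ₘ-++ˡ (weights 0 t xs) (replace (fewer left<t ∷ fewer right<t ∷ [])))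
  ; sn-args    = duplicate
  }
  where
  e = length xs
  t≡ : t ≡ ren (merge e) t'
  t≡ = Split-merge s
  prefix : weights 0 t' xs ≡ weights 0 t xs
  prefix = weights-cong 0 0 t' t xs λ i i<e → sym (trans (cong (occ i) t≡) (occ-ren-var (occ-merge-var-< i<e) t'))
  suffix : weights (suc (suc e)) t' ys ≡ weights (suc e) t ys
  suffix = weights-cong (suc (suc e)) (suc e) t' t ys λ i _ →
    sym (trans (cong (occ (suc e + i)) t≡) (occ-ren-var (occ-merge-var-> e i) t'))
  split-count : occ e t ≡ occ e t' + occ (suc e) t'
  split-count = trans (cong (occ e) t≡) (occ-merge e t')
  left≥1 : 1 ≤ occ e t'
  left≥1 = ≡.subst (1 ≤_) (trans (cong (occ 0) B'≡) (occ-jumpsAt t' xs (s≤s z≤n))) o₀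
  right≥1 : 1 ≤ occ (suc e) t'
  right≥1 = ≡.subst (1 ≤_) (trans (cong (occ 1) B'≡) (occ-jumpsAt t' xs (s≤s (s≤s z≤n)))) o₁
  left<t : occ e t' < occ e t
  left<t = ≡.subst (occ e t' <_) (sym split-count) (m<m+n (occ e t') right≥1)
  right<t : occ (suc e) t' < occ e t
  right<t = ≡.subst (occ (suc e) t' <_) (sym split-count) (m<n+m (occ (suc e) t') left≥1)
  duplicate : All SN (xs ++ u ∷ ys) → All SN (xs ++ u ∷ u ∷ ys)
  duplicate sn with ++⁻ xs sn
  ... | sn-xs , sn-u ∷ sn-ys = ++⁺ sn-xs (sn-u ∷ sn-u ∷ sn-ys)

jumpRedex-contraction : ∀ t xs u ys {r} → es (jumpsAt (suc (length ys)) t xs) (shiftBy (length ys) u) ↦ r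
                      → JumpContraction t (xs ++ u ∷ ys) (jumps r ys)
jumpRedex-contraction t xs u ys (w _)            = erase-jump t xs u ys
jumpRedex-contraction t xs u ys (d _)            = erase-jump t xs u ys
jumpRedex-contraction t xs u ys (c _ split o₀ o₁) = duplicate-jump t xs u ys split o₀ o₁

infix 4 _⟵⁺_
_⟵⁺_ : Tm → Tm → Set
_⟵⁺_ = TransClosure (flip _⟶_)

SN⁺ : Tm → Set
SN⁺ = Acc _⟵⁺_

⟶-⟶*-⟵⁺ : ∀ {a b c} → a ⟶ b → b ⟶* c → c ⟵⁺ a
⟶-⟶*-⟵⁺ s ε        = [ s ]⁺
⟶-⟶*-⟵⁺ s (s' ◅ p) = ⟶-⟶*-⟵⁺ s' p ∷ʳ s

⟶*-≡-or-⟵⁺ : ∀ {a b} → a ⟶* b → a ≡ b ⊎ b ⟵⁺ a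
⟶*-≡-or-⟵⁺ ε       = inj₁ refl
⟶*-≡-or-⟵⁺ (s ◅ p) = inj₂ (⟶-⟶*-⟵⁺ s p)

apps-⟶* : ∀ {h h'} vs → h ⟶* h' → apps h vs ⟶* apps h' vs
apps-⟶* vs = gmap (λ z → apps z vs) (apps-⟶ˡ vs)

module _ (t : Tm) (us vs : List Tm) (sn-us : All SN us)
  (by-reduct : ∀ t' us' vs' → apps (sub (listSub us') t') vs' ⟵⁺ apps (sub (listSub us) t) vs
             → All SN us' → SN (apps (jumps t' us') vs'))
  (by-smaller : ∀ t' us' → apps (sub (listSub us) t) vs ≡ apps (sub (listSub us') t') vs
              → weights 0 t' us' ≺ₘ weights 0 t us → All SN us' → SN (apps (jumps t' us') vs))
  where

  by-contraction : ∀ {r} → JumpContraction t us r → SN (apps r vs)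
  by-contraction contraction = ≡.subst (λ z → SN (apps z vs)) (sym reduct)
    (by-smaller t' us' (cong (λ z → apps z vs) (sym same-image)) smaller (sn-args sn-us))
    where open JumpContraction contraction

  reducts-sn : ∀ {r} → apps (jumps t us) vs ⟶ r → SN r
  reducts-sn s with apps-⟶-inv (jumps t us) vs s
  reducts-sn s | args {vs' = vs'} p = by-reduct t us vs' [ apps-⟶ʳ (sub (listSub us) t) p ]⁺ sn-us
  reducts-sn s | headRedex {vs = vs'} ρ with head-dB-simulation t us _ ρ
  ... | t⁺ , refl , s' = by-reduct t⁺ us vs' [ apps-⟶ˡ vs' s' ]⁺ sn-us
  reducts-sn s | head s' with jumps-⟶-inv t us s'
  ... | body {t' = t'} s'' = by-reduct t' us vs [ apps-⟶ˡ vs (⟶-sub (listSub us) s'') ]⁺ sn-us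
  ... | jumpRedex xs u ys ρ = by-contraction (jumpRedex-contraction t xs u ys ρ)
  ... | jumpArg {us' = us'} p with ⟶*-≡-or-⟵⁺ (apps-⟶* vs (sub-⟶* (listSub-⟶ₗ p) t))
  ...   | inj₁ same = by-smaller t us' same (weights-⟶ₗ 0 t p) (All-⟶ₗ sn-us p)
  ...   | inj₂ p⁺   = by-reduct t us' vs p⁺ (All-⟶ₗ sn-us p)

sn-jumps : ∀ {T} → SN⁺ T → ∀ t us vs → T ≡ apps (sub (listSub us) t) vs
         → Acc _≺ₘ_ (weights 0 t us) → All SN us → SN (apps (jumps t us) vs)
sn-jumps (acc outer) t us vs refl (acc inner) sn-us = acc (reducts-sn t us vs sn-us
  (λ t' us' vs' p sn' → sn-jumps (outer p) t' us' vs' refl (weights-acc sn' 0 t') sn')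
  (λ t' us' same smaller sn' → sn-jumps (acc outer) t' us' vs same (inner smaller) sn'))

theorem3p3 : (t : Tm) (us vs : List Tm) → 1 ≤ length us → All SN us
           → SN (apps (msubst t us) vs) → SN (apps (jumps t us) vs)
theorem3p3 t us vs _ sn-us sn-msubst =
  sn-jumps (accessible (flip _⟶_) sn-msubst) t us vs (cong (λ z → apps z vs) (msubst-as-sub t us))
           (weights-acc sn-us 0 t) sn-us
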